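{- Let $m\ge1$ be an integer, let $T$ and $S$ be disjoint finite sets of jobs, where each job $J_j$ has processing time $p_j\ge0$ and each $J_j\in S$ has rejection penalty $e_j\ge0$; let $t_1,\ldots,t_m$ be reals and $W$ a real number. Consider the linear program with variables $C_{\max}$, $x_j$ ($J_j\in S$) and $y_{ji}$ ($J_j\in T\cup S$, $i=1,\ldots,m$): $$\min\ C_{\max}+\sum_{J_j\in S}x_je_j$$ subject to $\sum_{i=1}^m y_{ji}=1$ for all $J_j\in T$; $x_j+\sum_{i=1}^m y_{ji}=1$ for all $J_j\in S$; $C_{\max}\ge t_i+\sum_{J_j\in T\cup S}y_{ji}p_j$ for all $i=1,\ldots,m$; $\sum_{J_j\in S}(1-x_j)p_j\le W$; and $x_j,y_{ji}\ge0$. For a basic feasible solution, let $T_1=\{J_j\in T: y_{ji}=1\text{ for some }i\}$, $T_2=T\setminus T_1$, $S_1=\{J_j\in S: y_{ji}=1\text{ for some }i\}$, $S_2=\{J_j\in S: x_j=1\}$ and $S_3=S\setminus(S_1\cup S_2)$. Then $|T_2|+|S_3|\le m+1$.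
   Context: In the paper, $T$ is the set of accepted risky jobs with processing time less than $\Delta$ (tiny jobs), $S$ the set of safe jobs, $t_i$ the total processing time of large jobs preassigned to machine $M_i$, and $W=U-\sum_{J_j\in A'_1}p_j$ with $A'_1$ the accepted risky jobs; the statement does not depend on these interpretations.
   Formalization: The data $p_j$, $e_j$, $t_1,\ldots,t_m$ and $W$, and the variables $C_{\max}$, $x_j$, $y_{ji}$ of the linear program, take values in ℚ rather than the reals. -}

module Defs where

open import Data.Nat using (ℕ; zero; suc)
open import Data.Fin using (Fin; zero; suc)
open import Data.Fin.Properties using (any?)
open import Data.List using (length; filter)
open import Data.List.Base using (allFin)
open import Data.Product using (Σ; _×_; ∃)
open import Relation.Nullary using (¬_; Dec)
open import Relation.Nullary.Decidable using (¬?; _×-dec_)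
open import Relation.Unary using (Decidable)
open import Relation.Binary.PropositionalEquality using (_≡_)
open import Data.Rational using (ℚ; 0ℚ; 1ℚ; _+_; _*_; _-_; _≤_)
open import Data.Rational.Properties using (_≟_)

∑ : ∀ {n} → (Fin n → ℚ) → ℚ
∑ {zero}  f = 0ℚ
∑ {suc n} f = f zero + ∑ (λ i → f (suc i))

count : ∀ {n} {P : Fin n → Set} → Decidable P → ℕ
count {n} P? = length (filter P? (allFin n))

-- Jobs of T are indexed by Fin a, jobs of S by Fin b (so T, S are disjoint),
-- machines by Fin m.
-- Data of an instance of the LP.
record Instance (m a b : ℕ) : Set where
  field
    pT : Fin a → ℚ
    pS : Fin b → ℚ
    e  : Fin b → ℚ
    t  : Fin m → ℚ
    W  : ℚ

record Point (m a b : ℕ) : Set where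
  field
    C  : ℚ
    x  : Fin b → ℚ
    yT : Fin a → Fin m → ℚ
    yS : Fin b → Fin m → ℚ

module _ {m a b : ℕ} (I : Instance m a b) where
  open Instance I

  load : Point m a b → Fin m → ℚ
  load P i = t i + (∑ (λ j → yT j i * pT j) + ∑ (λ j → yS j i * pS j))
    where open Point P

  accepted : Point m a b → ℚ
  accepted P = ∑ (λ j → (1ℚ - x j) * pS j)
    where open Point P

  record Feasible (P : Point m a b) : Set where
    open Point P
    field
      eqT    : ∀ j → ∑ (λ i → yT j i) ≡ 1ℚ
      eqS    : ∀ j → x j + ∑ (λ i → yS j i) ≡ 1ℚ
      mach   : ∀ i → load P i ≤ C
      budget : accepted P ≤ W
      x≥0    : ∀ j → 0ℚ ≤ x j
      yT≥0   : ∀ j i → 0ℚ ≤ yT j i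
      yS≥0   : ∀ j i → 0ℚ ≤ yS j i

  -- Basic feasible solution: P is feasible and the constraints active at P
  -- have full rank, i.e. the only direction D satisfying the homogeneous
  -- versions of all constraints that are tight at P is D = 0.
  record Basic (P : Point m a b) : Set where
    open Point P
    field
      feasible : Feasible P
      fullRank : (D : Point m a b) →
        (∀ j → ∑ (λ i → Point.yT D j i) ≡ 0ℚ) →
        (∀ j → Point.x D j + ∑ (λ i → Point.yS D j i) ≡ 0ℚ) →
        (∀ i → load P i ≡ C →
               ∑ (λ j → Point.yT D j i * pT j) + ∑ (λ j → Point.yS D j i * pS j)
                 ≡ Point.C D) →
        (accepted P ≡ W → ∑ (λ j → Point.x D j * pS j) ≡ 0ℚ) →
        (∀ j → x j ≡ 0ℚ → Point.x D j ≡ 0ℚ) →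
        (∀ j i → yT j i ≡ 0ℚ → Point.yT D j i ≡ 0ℚ) →
        (∀ j i → yS j i ≡ 0ℚ → Point.yS D j i ≡ 0ℚ) →
        (Point.C D ≡ 0ℚ) × (∀ j → Point.x D j ≡ 0ℚ) ×
        (∀ j i → Point.yT D j i ≡ 0ℚ) × (∀ j i → Point.yS D j i ≡ 0ℚ)

module _ {m a b : ℕ} (P : Point m a b) where
  open Point P

  InT₁ : Fin a → Set
  InT₁ j = ∃ λ i → yT j i ≡ 1ℚ

  inT₁? : Decidable InT₁
  inT₁? j = any? (λ i → yT j i ≟ 1ℚ)

  InS₁ : Fin b → Set
  InS₁ j = ∃ λ i → yS j i ≡ 1ℚ

  inS₁? : Decidable InS₁
  inS₁? j = any? (λ i → yS j i ≟ 1ℚ)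

  InS₂ : Fin b → Set
  InS₂ j = x j ≡ 1ℚ

  InT₂ : Fin a → Set
  InT₂ j = ¬ InT₁ j

  InS₃ : Fin b → Set
  InS₃ j = ¬ InS₁ j × ¬ InS₂ j

  ∣T₂∣ : ℕ
  ∣T₂∣ = count {P = InT₂} (λ j → ¬? (inT₁? j))

  ∣S₃∣ : ℕ
  ∣S₃∣ = count {P = InS₃} (λ j → ¬? (inS₁? j) ×-dec ¬? (x j ≟ 1ℚ))

{-# OPTIONS --safe #-}
-- Encode every job as a row of length m + 1 summing to 1: (0, y_j1, …, y_jm) for a job of T and
-- (x_j, y_j1, …, y_jm) for a job of S. The jobs of T₂ and S₃ are exactly the rows with no entry 1.
-- Such a row z has an entry z_u ∉ {0, 1}, so z − e_u is a nonzero perturbation of z inside its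
-- support with row sum 0. Weighting these perturbations by processing times gives vectors in
-- ℚ^(m+1) (budget and machine loads); if there were more than m + 1 of them, Gaussian elimination
-- would give a nontrivial combination with vanishing weighted sums, i.e. a nonzero direction
-- satisfying every constraint homogeneously, which basicness rules out.
module Submission where

open import Defs
open import Data.Nat using (ℕ; suc; _+_; _≤_; NonZero)
open import Data.Fin using (Fin)
open import Data.Rational using (ℚ; 0ℚ) renaming (_≤_ to _≤ℚ_)

open import Algebra.Bundles using (CommutativeRing)
open import Data.Bool using (true; false)
open import Data.Empty using (⊥; ⊥-elim)
open import Data.Fin using (zero; suc; punchIn; punchOut; _↑ˡ_; _↑ʳ_; splitAt; join)
open import Data.Fin.Properties
  using (join-splitAt; all?; any?; ¬∀⟶∃¬; punchIn-punchOut) renaming (_≟_ to _≟ᶠ_)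
open import Data.List using (length; filter; tabulate; allFin)
open import Data.List.Properties using (filter-≐)
open import Data.Nat using (zero; _<_; s≤s)
import Data.Nat.Properties as ℕ
open import Data.Product using (∃; _×_; _,_; proj₁; proj₂)
open import Data.Rational using (1ℚ; _*_; _-_; -_) renaming (_+_ to _+ℚ_)
open import Data.Rational.Properties as ℚ using (_≟_)
open import Data.Rational.Solver using (module +-*-Solver)
open import Data.Sum using (_⊎_; inj₁; inj₂; [_,_]′)
open import Data.Vec.Functional using (_∷_; _++_)
open import Data.Vec.Functional.Properties using (lookup-++ˡ; lookup-++ʳ)
open import Function using (_∘_)
open import Level using (0ℓ)
open import Relation.Binary.PropositionalEquality
open import Relation.Nullary using (¬_; Dec; yes; no; does)
open import Relation.Nullary.Decidable using (¬?; _×-dec_)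
open import Relation.Unary using (Pred; Decidable; _≐_)

open import Algebra.Properties.Semiring.Sum (CommutativeRing.semiring ℚ.+-*-commutativeRing)
  using (sum; sum-cong-≗; ∑-distrib-+; *-distribˡ-sum; sum-replicate-zero)
open import Algebra.Properties.Group ℚ.+-0-group using (x∙y⁻¹≈ε⇒x≈y)
open import Algebra.Apartness.Properties.HeytingCommutativeRing ℚ.heytingCommutativeRing
  using (x#0y#0→xy#0)

∑≡sum : ∀ {n} (f : Fin n → ℚ) → ∑ f ≡ sum f
∑≡sum {zero}  f = refl
∑≡sum {suc n} f = cong (f zero +ℚ_) (∑≡sum (f ∘ suc))

sum-zero : ∀ {n} (f : Fin n → ℚ) → (∀ i → f i ≡ 0ℚ) → sum f ≡ 0ℚ
sum-zero {n} f f≡0 = trans (sum-cong-≗ f≡0) (sum-replicate-zero n)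

sum-linear : ∀ {n} α β (f g : Fin n → ℚ) →
             sum (λ i → α * f i +ℚ β * g i) ≡ α * sum f +ℚ β * sum g
sum-linear α β f g = trans (∑-distrib-+ (λ i → α * f i) (λ i → β * g i))
  (sym (cong₂ _+ℚ_ (*-distribˡ-sum α f) (*-distribˡ-sum β g)))

sum-↑ : ∀ a {b} (f : Fin (a + b) → ℚ) →
        sum f ≡ sum (λ j → f (j ↑ˡ b)) +ℚ sum (λ j → f (a ↑ʳ j))
sum-↑ zero    f = sym (ℚ.+-identityˡ (sum f))
sum-↑ (suc a) {b} f = trans (cong (f zero +ℚ_) (sum-↑ a (f ∘ suc)))
  (sym (ℚ.+-assoc (f zero) (sum (λ j → f (suc (j ↑ˡ b)))) (sum (λ j → f (suc (a ↑ʳ j))))))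

sum≢0⇒∃≢0 : ∀ {n} (f : Fin n → ℚ) → sum f ≢ 0ℚ → ∃ λ i → f i ≢ 0ℚ
sum≢0⇒∃≢0 {zero}  f sum≢0 = ⊥-elim (sum≢0 refl)
sum≢0⇒∃≢0 {suc n} f sum≢0 with f zero ≟ 0ℚ
... | no  f₀≢0 = zero , f₀≢0
... | yes f₀≡0 with sum≢0⇒∃≢0 (f ∘ suc) (λ sum≡0 → sum≢0 (cong₂ _+ℚ_ f₀≡0 sum≡0))
...   | i , fᵢ≢0 = suc i , fᵢ≢0

↑-elim : ∀ {a b} {P : Fin (a + b) → Set} →
         (∀ j → P (j ↑ˡ b)) → (∀ j → P (a ↑ʳ j)) → ∀ l → P l
↑-elim {a} {b} {P} left right l = subst P (join-splitAt a b l) (on-split (splitAt a l))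
  where
  on-split : ∀ s → P (join a b s)
  on-split (inj₁ j) = left j
  on-split (inj₂ j) = right j

length-filter-tabulate : ∀ {a n} {A : Set a} {P : Pred A 0ℓ} (P? : Decidable P) (f : Fin n → A) →
                         length (filter P? (tabulate f)) ≡ count (λ i → P? (f i))
length-filter-tabulate {n = zero}  P? f = refl
length-filter-tabulate {n = suc n} P? f
  with does (P? (f zero))
     | trans (length-filter-tabulate P? (f ∘ suc)) (sym (length-filter-tabulate (λ i → P? (f i)) suc))
... | false | tail-count = tail-count
... | true  | tail-count = cong suc tail-count

count-↑ : ∀ a {b} {P : Pred (Fin (a + b)) 0ℓ} (P? : Decidable P) →
          count P? ≡ count (λ j → P? (j ↑ˡ b)) + count (λ j → P? (a ↑ʳ j))
count-↑ zero        P? = refl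
count-↑ (suc a) {b} P?
  with does (P? zero)
     | trans (length-filter-tabulate P? suc)
        (trans (count-↑ a (λ i → P? (suc i)))
          (cong (_+ count (λ j → P? (suc a ↑ʳ j))) (sym (length-filter-tabulate (λ j → P? (j ↑ˡ b)) suc))))
... | false | tail-count = tail-count
... | true  | tail-count = cong suc tail-count

count-≐ : ∀ {n} {P Q : Pred (Fin n) 0ℓ} (P? : Decidable P) (Q? : Decidable Q) →
          P ≐ Q → count P? ≡ count Q?
count-≐ {n} P? Q? P≐Q = cong length (filter-≐ P? Q? P≐Q (allFin n))

basis : ∀ {n} → Fin n → Fin n → ℚ
basis zero    zero    = 1ℚ
basis zero    (suc _) = 0ℚ
basis (suc _) zero    = 0ℚ
basis (suc u) (suc i) = basis u i

basis-diag : ∀ {n} (u : Fin n) → basis u u ≡ 1ℚ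
basis-diag zero    = refl
basis-diag (suc u) = basis-diag u

basis-off : ∀ {n} {u i : Fin n} → i ≢ u → basis u i ≡ 0ℚ
basis-off {u = zero}  {zero}  i≢u = ⊥-elim (i≢u refl)
basis-off {u = zero}  {suc i} i≢u = refl
basis-off {u = suc u} {zero}  i≢u = refl
basis-off {u = suc u} {suc i} i≢u = basis-off (i≢u ∘ cong suc)

sum-*-basis : ∀ {n} (f : Fin n → ℚ) (u : Fin n) → sum (λ i → f i * basis u i) ≡ f u
sum-*-basis f zero = trans
  (cong₂ _+ℚ_ (ℚ.*-identityʳ (f zero)) (sum-zero _ (λ i → ℚ.*-zeroʳ (f (suc i)))))
  (ℚ.+-identityʳ (f zero))
sum-*-basis f (suc u) = trans
  (cong₂ _+ℚ_ (ℚ.*-zeroʳ (f zero)) (sum-*-basis (f ∘ suc) u))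
  (ℚ.+-identityˡ (f (suc u)))

sum-basis : ∀ {n} (u : Fin n) → sum (basis u) ≡ 1ℚ
sum-basis u = trans (sum-cong-≗ (λ i → sym (ℚ.*-identityˡ (basis u i)))) (sum-*-basis (λ _ → 1ℚ) u)

record KernelVector {n k} (Q : Pred (Fin k) 0ℓ) (c : Fin n → Fin k → ℚ) : Set where
  field
    v       : Fin k → ℚ
    column  : Fin k
    flagged : Q column
    nonzero : v column ≢ 0ℚ
    solves  : ∀ r → sum (λ l → c r l * v l) ≡ 0ℚ

module _ {n k} {Q : Pred (Fin (suc k)) 0ℓ} {c : Fin n → Fin (suc k) → ℚ} where

  kernelVector-basis : Q zero → (∀ r → c r zero ≡ 0ℚ) → KernelVector Q c
  kernelVector-basis q c₀≡0 = record
    { v = basis zero ; column = zero ; flagged = q ; nonzero = ℚ.1≢0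
    ; solves = λ r → trans (sum-*-basis (c r) zero) (c₀≡0 r) }

  kernelVector-shift : KernelVector (Q ∘ suc) (λ r l → c r (suc l)) → KernelVector Q c
  kernelVector-shift μ = record
    { v = 0ℚ ∷ v ; column = suc column ; flagged = flagged ; nonzero = nonzero
    ; solves = shifted-solves }
    where
    open KernelVector μ
    shifted-solves : ∀ r → sum (λ l → c r l * (0ℚ ∷ v) l) ≡ 0ℚ
    shifted-solves r = trans (cong (_+ℚ tail) (ℚ.*-zeroʳ (c r zero))) (trans (ℚ.+-identityˡ tail) (solves r))
      where
      tail : ℚ
      tail = sum (λ l → c r (suc l) * v l)

eliminate : ∀ {n k} → (Fin (suc n) → Fin (suc k) → ℚ) → Fin (suc n) → Fin n → Fin k → ℚ
eliminate c r₀ r l = c r₀ zero * c (punchIn r₀ r) (suc l) - c (punchIn r₀ r) zero * c r₀ (suc l)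

module _ {n k} {Q : Pred (Fin (suc k)) 0ℓ} {c : Fin (suc n) → Fin (suc k) → ℚ} where
  open +-*-Solver

  kernelVector-pivot : (r₀ : Fin (suc n)) → c r₀ zero ≢ 0ℚ →
                       KernelVector (Q ∘ suc) (eliminate c r₀) → KernelVector Q c
  kernelVector-pivot r₀ p≢0 μ = record
    { v = w ; column = suc column ; flagged = flagged
    ; nonzero = x#0y#0→xy#0 p≢0 nonzero
    ; solves = λ r → trans (row≡residual r) (residual≡0 r) }
    where
    open KernelVector μ
    p : ℚ
    p = c r₀ zero
    A : Fin (suc n) → ℚ
    A r = sum (λ l → c r (suc l) * v l)
    w : Fin (suc k) → ℚ
    w = (- A r₀) ∷ (λ l → p * v l)
    residual : Fin (suc n) → ℚ
    residual r = p * A r +ℚ (- c r zero) * A r₀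

    row≡residual : ∀ r → sum (λ l → c r l * w l) ≡ residual r
    row≡residual r = begin
      c r zero * (- A r₀) +ℚ sum (λ l → c r (suc l) * (p * v l))
        ≡⟨ cong (c r zero * (- A r₀) +ℚ_) (trans
             (sum-cong-≗ (λ l → solve 3 (λ a b d → a :* (b :* d) := b :* (a :* d)) refl (c r (suc l)) p (v l)))
             (sym (*-distribˡ-sum p (λ l → c r (suc l) * v l)))) ⟩
      c r zero * (- A r₀) +ℚ p * A r
        ≡⟨ solve 4 (λ c₀ A₀ p Aᵣ → c₀ :* (:- A₀) :+ p :* Aᵣ := p :* Aᵣ :+ (:- c₀) :* A₀)
                   refl (c r zero) (A r₀) p (A r) ⟩
      residual r ∎
      where open ≡-Reasoning

    eliminated≡residual : ∀ r → sum (λ l → eliminate c r₀ r l * v l) ≡ residual (punchIn r₀ r)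
    eliminated≡residual r = trans
      (sum-cong-≗ (λ l → solve 5 (λ p a b e x → (p :* a :- b :* e) :* x := p :* (a :* x) :+ (:- b) :* (e :* x))
                                 refl p (c r′ (suc l)) (c r′ zero) (c r₀ (suc l)) (v l)))
      (sum-linear p (- c r′ zero) (λ l → c r′ (suc l) * v l) (λ l → c r₀ (suc l) * v l))
      where
      r′ : Fin (suc n)
      r′ = punchIn r₀ r

    residual≡0 : ∀ r → residual r ≡ 0ℚ
    residual≡0 r with r₀ ≟ᶠ r
    ... | yes refl = solve 2 (λ p A → p :* A :+ (:- p) :* A := con 0ℚ) refl p (A r₀)
    ... | no  r₀≢r = begin
      residual r                                           ≡⟨ cong residual (sym (punchIn-punchOut r₀≢r)) ⟩
      residual (punchIn r₀ (punchOut r₀≢r))                ≡⟨ eliminated≡residual (punchOut r₀≢r) ⟨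
      sum (λ l → eliminate c r₀ (punchOut r₀≢r) l * v l)  ≡⟨ solves (punchOut r₀≢r) ⟩
      0ℚ                                                   ∎
      where open ≡-Reasoning

rows<flagged⇒kernelVector : ∀ {n k} {Q : Pred (Fin k) 0ℓ} (Q? : Decidable Q) (c : Fin n → Fin k → ℚ) →
                            n < count Q? → KernelVector Q c
rows<flagged⇒kernelVector {k = zero} Q? c ()
rows<flagged⇒kernelVector {n} {suc k} Q? c n<count with Q? zero | length-filter-tabulate Q? suc
... | no  _ | tail-count = kernelVector-shift
  (rows<flagged⇒kernelVector (Q? ∘ suc) (λ r l → c r (suc l)) (subst (n <_) tail-count n<count))
rows<flagged⇒kernelVector {zero}  {suc k} Q? c _ | yes q | _ = kernelVector-basis q (λ ())
rows<flagged⇒kernelVector {suc n} {suc k} Q? c (s≤s n<count) | yes q | tail-count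
  with all? (λ r → c r zero ≟ 0ℚ)
... | yes c₀≡0 = kernelVector-basis q c₀≡0
... | no  c₀≢0 with ¬∀⟶∃¬ _ _ (λ r → c r zero ≟ 0ℚ) c₀≢0
...   | r₀ , pivot≢0 = kernelVector-pivot r₀ pivot≢0
  (rows<flagged⇒kernelVector (Q? ∘ suc) (eliminate c r₀) (subst (n <_) tail-count n<count))

nonzero-entry : ∀ {n} (z : Fin n → ℚ) → sum z ≡ 1ℚ → ∃ λ u → z u ≢ 0ℚ
nonzero-entry z sum≡1 = sum≢0⇒∃≢0 z (λ sum≡0 → ℚ.1≢0 (trans (sym sum≡1) sum≡0))

deviation : ∀ {n} → (Fin n → ℚ) → Fin n → Fin n → ℚ
deviation z u i = z i - basis u i

module _ {n} (z : Fin n → ℚ) (u : Fin n) where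
  open +-*-Solver

  sum-deviation : sum z ≡ 1ℚ → sum (deviation z u) ≡ 0ℚ
  sum-deviation sum≡1 = begin
    sum (deviation z u)
      ≡⟨ sum-cong-≗ (λ i → solve 2 (λ a e → a :- e := con 1ℚ :* a :+ con (- 1ℚ) :* e) refl (z i) (basis u i)) ⟩
    sum (λ i → 1ℚ * z i +ℚ (- 1ℚ) * basis u i)
      ≡⟨ sum-linear 1ℚ (- 1ℚ) z (basis u) ⟩
    1ℚ * sum z +ℚ (- 1ℚ) * sum (basis u)
      ≡⟨ cong₂ (λ s t → 1ℚ * s +ℚ (- 1ℚ) * t) sum≡1 (sum-basis u) ⟩
    0ℚ ∎
    where open ≡-Reasoning

  deviation-support : z u ≢ 0ℚ → ∀ {i} → z i ≡ 0ℚ → deviation z u i ≡ 0ℚ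
  deviation-support zᵤ≢0 {i} zᵢ≡0 = cong₂ _-_ zᵢ≡0 (basis-off {u = u} {i} λ { refl → zᵤ≢0 zᵢ≡0 })

  deviation-nonzero : z u ≢ 1ℚ → deviation z u u ≢ 0ℚ
  deviation-nonzero zᵤ≢1 dev≡0 =
    zᵤ≢1 (x∙y⁻¹≈ε⇒x≈y (z u) 1ℚ (trans (cong (_-_ (z u)) (sym (basis-diag u))) dev≡0))

HasUnitEntry : ∀ {k} → (Fin k → ℚ) → Set
HasUnitEntry z = ∃ λ r → z r ≡ 1ℚ

hasUnitEntry? : ∀ {k} (z : Fin k → ℚ) → Dec (HasUnitEntry z)
hasUnitEntry? z = any? (λ r → z r ≟ 1ℚ)

module _ {k} {x : ℚ} {z : Fin k → ℚ} where

  hasUnitEntry-∷⁺ : x ≡ 1ℚ ⊎ HasUnitEntry z → HasUnitEntry (x ∷ z)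
  hasUnitEntry-∷⁺ (inj₁ x≡1)       = zero , x≡1
  hasUnitEntry-∷⁺ (inj₂ (r , z≡1)) = suc r , z≡1

  hasUnitEntry-∷⁻ : HasUnitEntry (x ∷ z) → x ≡ 1ℚ ⊎ HasUnitEntry z
  hasUnitEntry-∷⁻ (zero  , x≡1) = inj₁ x≡1
  hasUnitEntry-∷⁻ (suc r , z≡1) = inj₂ (r , z≡1)

module _ {N k} (z : Fin N → Fin k → ℚ) (p : Fin N → ℚ) where

  -- For the rows and weights of an LP point below, the three hypotheses on D are the homogeneous
  -- assignment, load/budget and nonnegativity constraints, so Rigid is what basicness provides.
  Rigid : Set
  Rigid = (D : Fin N → Fin k → ℚ) →
          (∀ l → sum (D l) ≡ 0ℚ) →
          (∀ l r → z l r ≡ 0ℚ → D l r ≡ 0ℚ) →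
          (∀ r → sum (λ l → D l r * p l) ≡ 0ℚ) →
          ∀ l r → D l r ≡ 0ℚ

  rigid⇒count-fractional≤ : (∀ l → sum (z l) ≡ 1ℚ) → Rigid →
                            count (λ l → ¬? (hasUnitEntry? (z l))) ≤ k
  rigid⇒count-fractional≤ rows≡1 rigid =
    ℕ.≮⇒≥ (no-fractional-kernelVector ∘ rows<flagged⇒kernelVector (λ l → ¬? (hasUnitEntry? (z l))) c)
    where
    open +-*-Solver

    u : Fin N → Fin k
    u l = proj₁ (nonzero-entry (z l) (rows≡1 l))

    δ : Fin N → Fin k → ℚ
    δ l = deviation (z l) (u l)

    c : Fin k → Fin N → ℚ
    c r l = δ l r * p l

    no-fractional-kernelVector : KernelVector (λ l → ¬ HasUnitEntry (z l)) c → ⊥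
    no-fractional-kernelVector μ = x#0y#0→xy#0 nonzero
      (deviation-nonzero (z column) (u column) (flagged ∘ (u column ,_)))
      (rigid D D-sums D-support D-loads column (u column))
      where
      open KernelVector μ
      D : Fin N → Fin k → ℚ
      D l r = v l * δ l r

      D-sums : ∀ l → sum (D l) ≡ 0ℚ
      D-sums l = trans (sym (*-distribˡ-sum (v l) (δ l)))
        (trans (cong (v l *_) (sum-deviation (z l) (u l) (rows≡1 l))) (ℚ.*-zeroʳ (v l)))

      D-support : ∀ l r → z l r ≡ 0ℚ → D l r ≡ 0ℚ
      D-support l r zₗᵣ≡0 = trans
        (cong (v l *_) (deviation-support (z l) (u l) (proj₂ (nonzero-entry (z l) (rows≡1 l))) zₗᵣ≡0))
        (ℚ.*-zeroʳ (v l))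

      D-loads : ∀ r → sum (λ l → D l r * p l) ≡ 0ℚ
      D-loads r = trans
        (sum-cong-≗ (λ l → solve 3 (λ a b e → (a :* b) :* e := (b :* e) :* a) refl (v l) (δ l r) (p l)))
        (solves r)

module _ {m a b} (I : Instance m a b) (P : Point m a b) where
  open Instance I
  open Point P

  rows : Fin (a + b) → Fin (suc m) → ℚ
  rows = (λ j → 0ℚ ∷ yT j) ++ (λ j → x j ∷ yS j)

  weights : Fin (a + b) → ℚ
  weights = pT ++ pS

  rows-T : ∀ j → rows (j ↑ˡ b) ≡ 0ℚ ∷ yT j
  rows-T = lookup-++ˡ (λ j → 0ℚ ∷ yT j) (λ j → x j ∷ yS j)

  rows-S : ∀ j → rows (a ↑ʳ j) ≡ x j ∷ yS j
  rows-S = lookup-++ʳ (λ j → 0ℚ ∷ yT j) (λ j → x j ∷ yS j)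

  rows-sum : Feasible I P → ∀ l → sum (rows l) ≡ 1ℚ
  rows-sum F = ↑-elim
    (λ j → subst (λ z → sum z ≡ 1ℚ) (sym (rows-T j))
             (trans (ℚ.+-identityˡ (sum (yT j))) (trans (sym (∑≡sum (yT j))) (eqT j))))
    (λ j → subst (λ z → sum z ≡ 1ℚ) (sym (rows-S j))
             (trans (cong (x j +ℚ_) (sym (∑≡sum (yS j)))) (eqS j)))
    where open Feasible F

  basic⇒rigid : Basic I P → Rigid rows weights
  basic⇒rigid B D D-sums D-support D-loads = ↑-elim T-vanishes S-vanishes
    where
    support-T : ∀ j r → (0ℚ ∷ yT j) r ≡ 0ℚ → D (j ↑ˡ b) r ≡ 0ℚ
    support-T j r z≡0 = D-support (j ↑ˡ b) r (trans (cong-app (rows-T j) r) z≡0)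

    support-S : ∀ j r → (x j ∷ yS j) r ≡ 0ℚ → D (a ↑ʳ j) r ≡ 0ℚ
    support-S j r z≡0 = D-support (a ↑ʳ j) r (trans (cong-app (rows-S j) r) z≡0)

    weighted-split : ∀ r → sum (λ l → D l r * weights l) ≡
                     sum (λ j → D (j ↑ˡ b) r * pT j) +ℚ sum (λ j → D (a ↑ʳ j) r * pS j)
    weighted-split r = trans (sum-↑ a (λ l → D l r * weights l)) (cong₂ _+ℚ_
      (sum-cong-≗ (λ j → cong (D (j ↑ˡ b) r *_) (lookup-++ˡ pT pS j)))
      (sum-cong-≗ (λ j → cong (D (a ↑ʳ j) r *_) (lookup-++ʳ pT pS j))))

    T-sums : ∀ j → ∑ (λ i → D (j ↑ˡ b) (suc i)) ≡ 0ℚ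
    T-sums j = begin
      ∑ (λ i → D (j ↑ˡ b) (suc i))          ≡⟨ ∑≡sum (λ i → D (j ↑ˡ b) (suc i)) ⟩
      sum (λ i → D (j ↑ˡ b) (suc i))        ≡⟨ ℚ.+-identityˡ (sum (λ i → D (j ↑ˡ b) (suc i))) ⟨
      0ℚ +ℚ sum (λ i → D (j ↑ˡ b) (suc i))  ≡⟨ cong (_+ℚ sum (λ i → D (j ↑ˡ b) (suc i))) (support-T j zero refl) ⟨
      sum (D (j ↑ˡ b))                      ≡⟨ D-sums (j ↑ˡ b) ⟩
      0ℚ                                    ∎
      where open ≡-Reasoning

    S-sums : ∀ j → D (a ↑ʳ j) zero +ℚ ∑ (λ i → D (a ↑ʳ j) (suc i)) ≡ 0ℚ
    S-sums j = trans (cong (D (a ↑ʳ j) zero +ℚ_) (∑≡sum (λ i → D (a ↑ʳ j) (suc i)))) (D-sums (a ↑ʳ j))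

    loads : ∀ i → ∑ (λ j → D (j ↑ˡ b) (suc i) * pT j) +ℚ ∑ (λ j → D (a ↑ʳ j) (suc i) * pS j) ≡ 0ℚ
    loads i = trans
      (cong₂ _+ℚ_ (∑≡sum (λ j → D (j ↑ˡ b) (suc i) * pT j)) (∑≡sum (λ j → D (a ↑ʳ j) (suc i) * pS j)))
      (trans (sym (weighted-split (suc i))) (D-loads (suc i)))

    budget : ∑ (λ j → D (a ↑ʳ j) zero * pS j) ≡ 0ℚ
    budget = begin
      ∑ (λ j → D (a ↑ʳ j) zero * pS j)          ≡⟨ ∑≡sum (λ j → D (a ↑ʳ j) zero * pS j) ⟩
      sum (λ j → D (a ↑ʳ j) zero * pS j)        ≡⟨ ℚ.+-identityˡ (sum (λ j → D (a ↑ʳ j) zero * pS j)) ⟨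
      0ℚ +ℚ sum (λ j → D (a ↑ʳ j) zero * pS j)  ≡⟨ cong (_+ℚ sum (λ j → D (a ↑ʳ j) zero * pS j)) T-budget ⟨
      sum (λ j → D (j ↑ˡ b) zero * pT j) +ℚ sum (λ j → D (a ↑ʳ j) zero * pS j)
                                                ≡⟨ weighted-split zero ⟨
      sum (λ l → D l zero * weights l)          ≡⟨ D-loads zero ⟩
      0ℚ                                        ∎
      where
      open ≡-Reasoning
      T-budget : sum (λ j → D (j ↑ˡ b) zero * pT j) ≡ 0ℚ
      T-budget = sum-zero (λ j → D (j ↑ˡ b) zero * pT j)
        (λ j → trans (cong (_* pT j) (support-T j zero refl)) (ℚ.*-zeroˡ (pT j)))

    direction : Point m a b
    direction = record
      { C  = 0ℚ
      ; x  = λ j → D (a ↑ʳ j) zero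
      ; yT = λ j i → D (j ↑ˡ b) (suc i)
      ; yS = λ j i → D (a ↑ʳ j) (suc i) }

    vanishes : (0ℚ ≡ 0ℚ) × (∀ j → D (a ↑ʳ j) zero ≡ 0ℚ) ×
               (∀ j i → D (j ↑ˡ b) (suc i) ≡ 0ℚ) × (∀ j i → D (a ↑ʳ j) (suc i) ≡ 0ℚ)
    vanishes = Basic.fullRank B direction T-sums S-sums (λ i _ → loads i) (λ _ → budget)
      (λ j → support-S j zero) (λ j i → support-T j (suc i)) (λ j i → support-S j (suc i))

    T-vanishes : ∀ j r → D (j ↑ˡ b) r ≡ 0ℚ
    T-vanishes j zero    = support-T j zero refl
    T-vanishes j (suc i) = proj₁ (proj₂ (proj₂ vanishes)) j i

    S-vanishes : ∀ j r → D (a ↑ʳ j) r ≡ 0ℚ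
    S-vanishes j zero    = proj₁ (proj₂ vanishes) j
    S-vanishes j (suc i) = proj₂ (proj₂ (proj₂ vanishes)) j i

  count-fractional≡∣T₂∣+∣S₃∣ : count (λ l → ¬? (hasUnitEntry? (rows l))) ≡ ∣T₂∣ P + ∣S₃∣ P
  count-fractional≡∣T₂∣+∣S₃∣ = trans (count-↑ a (λ l → ¬? (hasUnitEntry? (rows l)))) (cong₂ _+_
    (count-≐ (λ j → ¬? (hasUnitEntry? (rows (j ↑ˡ b)))) (λ j → ¬? (inT₁? P j))
             (T-fractional⇒T₂ , T₂⇒T-fractional))
    (count-≐ (λ j → ¬? (hasUnitEntry? (rows (a ↑ʳ j)))) (λ j → ¬? (inS₁? P j) ×-dec ¬? (x j ≟ 1ℚ))
             (S-fractional⇒S₃ , S₃⇒S-fractional)))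
    where
    T-fractional⇒T₂ : ∀ {j} → ¬ HasUnitEntry (rows (j ↑ˡ b)) → InT₂ P j
    T-fractional⇒T₂ {j} ¬unit = ¬unit ∘ subst HasUnitEntry (sym (rows-T j)) ∘ hasUnitEntry-∷⁺ ∘ inj₂

    T₂⇒T-fractional : ∀ {j} → InT₂ P j → ¬ HasUnitEntry (rows (j ↑ˡ b))
    T₂⇒T-fractional {j} ¬T₁ unit =
      [ (λ 0≡1 → ℚ.1≢0 (sym 0≡1)) , ¬T₁ ]′ (hasUnitEntry-∷⁻ (subst HasUnitEntry (rows-T j) unit))

    S-fractional⇒S₃ : ∀ {j} → ¬ HasUnitEntry (rows (a ↑ʳ j)) → InS₃ P j
    S-fractional⇒S₃ {j} ¬unit = (¬unit ∘ S-unit ∘ inj₂) , (¬unit ∘ S-unit ∘ inj₁)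
      where
      S-unit : x j ≡ 1ℚ ⊎ HasUnitEntry (yS j) → HasUnitEntry (rows (a ↑ʳ j))
      S-unit = subst HasUnitEntry (sym (rows-S j)) ∘ hasUnitEntry-∷⁺

    S₃⇒S-fractional : ∀ {j} → InS₃ P j → ¬ HasUnitEntry (rows (a ↑ʳ j))
    S₃⇒S-fractional {j} (¬S₁ , ¬S₂) unit =
      [ ¬S₂ , ¬S₁ ]′ (hasUnitEntry-∷⁻ (subst HasUnitEntry (rows-S j) unit))

lemma9 : (m a b : ℕ) → .{{NonZero m}} → (I : Instance m a b) →
    (∀ j → 0ℚ ≤ℚ Instance.pT I j) → (∀ j → 0ℚ ≤ℚ Instance.pS I j) →
    (∀ j → 0ℚ ≤ℚ Instance.e I j) →
    (P : Point m a b) → Basic I P →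
    ∣T₂∣ P + ∣S₃∣ P ≤ m + 1
lemma9 m a b I _ _ _ P B = begin
  ∣T₂∣ P + ∣S₃∣ P                                 ≡⟨ count-fractional≡∣T₂∣+∣S₃∣ I P ⟨
  count (λ l → ¬? (hasUnitEntry? (rows I P l)))  ≤⟨ rigid⇒count-fractional≤ (rows I P) (weights I P)
                                                      (rows-sum I P (Basic.feasible B)) (basic⇒rigid I P B) ⟩
  suc m                                           ≡⟨ ℕ.+-comm 1 m ⟩
  m + 1                                           ∎
  where open ℕ.≤-Reasoning
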